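{- Let $M$ be an $n\times n$ $(0,1)$-matrix that is $\epsilon$-far from binary rank at most $d$. Consider the algorithm that selects $m=24(2^d+1)/\epsilon$ entries of $M$ uniformly, independently at random, lets $U$ be the set of selected entries and $W$ the submatrix of $M$ induced by $U$, and accepts if and only if $W$ has binary rank at most $d$. Then this algorithm rejects with probability at least $2/3$.
   Context: The binary rank of a $(0,1)$-matrix is the minimal number of all-ones combinatorial rectangles (sets of rows times sets of columns on which all entries are $1$) needed to partition its $1$-entries (equivalently, the minimal inner dimension of a factorization into $(0,1)$-matrices over the reals). $M$ is $\epsilon$-far from binary rank at most $d$ if more than $\epsilon n^2$ entries must be modified to obtain a matrix of binary rank at most $d$. For a set of entries $U=\{(x_i,y_i)\}_{i=1}^m$, the submatrix induced by $U$ has rows $\{x_i\}$ and columns $\{y_i\}$.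
   Formalization: The distance parameter $\epsilon$ ranges over the positive rationals. -}

module Defs where

open import Data.Bool using (Bool; true; false; if_then_else_; _∧_)
open import Data.Nat using (ℕ; zero; suc; _+_; _*_; _∸_; _^_; _≤_; _<_; NonZero)
open import Data.Nat.DivMod using (_/_)
open import Data.Fin using (Fin; zero; suc)
open import Data.Product using (Σ; ∃; _×_; _,_; proj₁; proj₂)
open import Data.List using (List; []; _∷_; map; allFin; cartesianProduct; concatMap)
open import Data.List.Membership.Propositional using (_∈_)
open import Data.Vec using (Vec; []; _∷_; toList)
open import Relation.Binary.PropositionalEquality using (_≡_)

Matrix : Set → Set → Set
Matrix A B = A → B → Bool

Mat : ℕ → Set
Mat n = Matrix (Fin n) (Fin n)

count : ∀ {k} → (Fin k → Bool) → ℕ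
count {zero}  f = 0
count {suc k} f = (if f zero then 1 else 0) + count (λ i → f (suc i))

bit : Bool → ℕ
bit true  = 1
bit false = 0

-- Binary rank at most d: the 1-entries of M are partitioned by d all-ones
-- combinatorial rectangles R k × C k (possibly empty): every entry lies in
-- exactly M a b (as 0/1) of the rectangles.  Every entry inside a rectangle
-- is then a 1-entry, so rectangles are all-ones, pairwise disjoint, and cover
-- all 1-entries.
BinRankLe : ∀ {A B : Set} → ℕ → Matrix A B → Set
BinRankLe {A} {B} d M =
  Σ (Fin d → A → Bool) λ R →
  Σ (Fin d → B → Bool) λ C →
  ∀ (a : A) (b : B) → count (λ k → R k a ∧ C k b) ≡ bit (M a b)

sumFin : ∀ {k} → (Fin k → ℕ) → ℕ
sumFin {zero}  f = 0
sumFin {suc k} f = f zero + sumFin (λ i → f (suc i))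

differ : Bool → Bool → Bool
differ true  true  = false
differ false false = false
differ _     _     = true

dist : ∀ {n} → Mat n → Mat n → ℕ
dist M M' = sumFin (λ i → count (λ j → differ (M i j) (M' i j)))

-- M is ε-far from binary rank at most d, with ε = p / q:
-- every matrix of binary rank ≤ d differs from M in more than ε n² entries.
FarFromBinRank : ∀ {n} → (p q : ℕ) → ℕ → Mat n → Set
FarFromBinRank {n} p q d M =
  ∀ (M' : Mat n) → BinRankLe d M' → p * (n * n) < q * dist M M'

ceilDiv : ℕ → (p : ℕ) → .{{NonZero p}} → ℕ
ceilDiv a p = (a + p ∸ 1) / p

-- The sample space: all sequences of m entries of an n×n matrix
-- (uniform distribution = counting measure on this list, of length (n*n)^m).
allSamples : (n m : ℕ) → List (Vec (Fin n × Fin n) m)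
allSamples n zero    = [] ∷ []
allSamples n (suc m) =
  concatMap (λ e → map (e ∷_) (allSamples n m))
            (cartesianProduct (allFin n) (allFin n))

Rows : ∀ {n} → List (Fin n × Fin n) → Set
Rows {n} U = Σ (Fin n) λ x → x ∈ map proj₁ U

Cols : ∀ {n} → List (Fin n × Fin n) → Set
Cols {n} U = Σ (Fin n) λ y → y ∈ map proj₂ U

induced : ∀ {n} → Mat n → (U : List (Fin n × Fin n)) → Matrix (Rows U) (Cols U)
induced M U (x , _) (y , _) = M x y

Accepts : ∀ {n m} → ℕ → Mat n → Vec (Fin n × Fin n) m → Set
Accepts d M s = BinRankLe d (induced M (toList s))

sampleSize : (d p q : ℕ) → .{{NonZero p}} → ℕ
sampleSize d p q = ceilDiv (24 * (2 ^ d + 1) * q) p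

countList : ∀ {A : Set} → (A → Bool) → List A → ℕ
countList f []       = 0
countList f (x ∷ xs) = (if f x then 1 else 0) + countList f xs

module Submission where

-- Read the sample from left to right while maintaining a submatrix W of M whose rows and
-- columns come from the sample and are pairwise distinct as rows and columns of W; stop as
-- soon as W has binary rank > d.  While rank W ≤ d, W has at most 2^d distinct rows and at
-- most 2^d distinct columns, and a factorisation of W extends to an n × n matrix M′ of binary
-- rank ≤ d (copy the entry of W at a row and a column of W agreeing with the sampled row and
-- column, 0 if there is none).  Every sampled entry on which M and M′ differ makes W grow.
-- As M is ε-far, W therefore grows with probability at least ε at every live step, and the
-- expected number of live steps is at most 2(2^d + 1)/ε ≤ m/12.  By Markov's inequality the
-- process stops before the end of the sample with probability ≥ 11/12; then W is a submatrix
-- of the induced submatrix, which therefore has binary rank > d as well.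

open import Defs
open import Data.Bool using (Bool; true; false; if_then_else_; not; _∧_; T; T?)
import Data.Bool.Properties as Bool
open import Data.Empty using (⊥-elim)
open import Data.Fin using (Fin; zero; suc; funToFin; finToFun)
open import Data.Fin.Properties using (2↔Bool; finToFun-funToFin; injective⇒≤; all?)
open import Data.List using (List; []; _∷_; _++_; map; concatMap; tabulate; allFin; cartesianProduct)
open import Data.List.Membership.Propositional using (_∈_)
open import Data.List.Membership.Propositional.Properties using (∈-map⁺)
open import Data.List.Relation.Unary.Any using (here; there)
open import Data.Maybe using (Maybe; just; nothing)
open import Data.Nat using (ℕ; zero; suc; _+_; _*_; _∸_; _^_; _≤_; _<_; _<ᵇ_; z≤n; s≤s; s≤s⁻¹; _≟_; NonZero; >-nonZero)
open import Data.Nat.DivMod using (_/_; _%_; m≡m%n+[m/n]*n; m%n<n)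
open import Data.Nat.Properties
open import Data.Nat.Tactic.RingSolver using (solve-∀)
open import Data.Product using (Σ; ∃; _×_; _,_; proj₁; proj₂)
open import Data.Sum using (_⊎_; inj₁; inj₂)
import Data.Sum as Sum
open import Data.Vec using (Vec; []; _∷_; toList)
import Data.Vec as Vec
open import Data.Vec.Properties using (lookup∘tabulate)
open import Data.Vec.Relation.Unary.All using (All; []; _∷_)
import Data.Vec.Relation.Unary.All as All
import Data.Vec.Relation.Unary.All.Properties as All
open import Data.Vec.Relation.Unary.AllPairs using ([]; _∷_)
import Data.Vec.Relation.Unary.AllPairs as AllPairs
open import Data.Vec.Relation.Unary.Any using (Any)
import Data.Vec.Relation.Unary.Any as Any
open import Data.Vec.Relation.Unary.Any.Properties using (lookup-index)
open import Data.Vec.Relation.Unary.Unique.Setoid using (Unique)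
open import Data.Vec.Relation.Unary.Unique.Setoid.Properties using (lookup-injective)
open import Function using (_∘_)
open import Function.Bundles using (Inverse; Equivalence)
open import Level using (0ℓ)
open import Relation.Binary.Bundles using (Setoid)
import Relation.Binary.Construct.On as On
open import Relation.Binary.PropositionalEquality
  using (_≡_; _≢_; refl; sym; trans; cong; cong₂; subst; _→-setoid_; module ≡-Reasoning)
open import Relation.Nullary using (Dec; yes; no; ¬_)
open import Relation.Nullary.Decidable using (map′; _⊎-dec_; toSum; isYes; toWitness; fromWitness)

private
  variable
    A B : Set

-- Finite sums

sumMap : (A → ℕ) → List A → ℕ
sumMap f []       = 0
sumMap f (x ∷ xs) = f x + sumMap f xs

sumMap-cong : ∀ {f g : A → ℕ} xs → (∀ x → f x ≡ g x) → sumMap f xs ≡ sumMap g xs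
sumMap-cong []       f≗g = refl
sumMap-cong (x ∷ xs) f≗g = cong₂ _+_ (f≗g x) (sumMap-cong xs f≗g)

sumMap-mono : ∀ {f g : A → ℕ} xs → (∀ x → f x ≤ g x) → sumMap f xs ≤ sumMap g xs
sumMap-mono []       f≤g = z≤n
sumMap-mono (x ∷ xs) f≤g = +-mono-≤ (f≤g x) (sumMap-mono xs f≤g)

sumMap-++ : ∀ (f : A → ℕ) xs ys → sumMap f (xs ++ ys) ≡ sumMap f xs + sumMap f ys
sumMap-++ f []       ys = refl
sumMap-++ f (x ∷ xs) ys = trans (cong (f x +_) (sumMap-++ f xs ys)) (sym (+-assoc (f x) _ _))

sumMap-+ : ∀ (f g : A → ℕ) xs → sumMap (λ x → f x + g x) xs ≡ sumMap f xs + sumMap g xs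
sumMap-+ f g []       = refl
sumMap-+ f g (x ∷ xs) = trans (cong (f x + g x +_) (sumMap-+ f g xs)) (interchange (f x) (g x) _ _)
  where
  interchange : ∀ a b c d → a + b + (c + d) ≡ a + c + (b + d)
  interchange = solve-∀

sumMap-*ˡ : ∀ c (f : A → ℕ) xs → sumMap (λ x → c * f x) xs ≡ c * sumMap f xs
sumMap-*ˡ c f []       = sym (*-zeroʳ c)
sumMap-*ˡ c f (x ∷ xs) = trans (cong (c * f x +_) (sumMap-*ˡ c f xs)) (sym (*-distribˡ-+ c (f x) _))

sumMap-map : ∀ (f : B → ℕ) (g : A → B) xs → sumMap f (map g xs) ≡ sumMap (λ x → f (g x)) xs
sumMap-map f g []       = refl
sumMap-map f g (x ∷ xs) = cong (f (g x) +_) (sumMap-map f g xs)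

sumMap-concatMap : ∀ (f : B → ℕ) (g : A → List B) xs →
  sumMap f (concatMap g xs) ≡ sumMap (λ x → sumMap f (g x)) xs
sumMap-concatMap f g []       = refl
sumMap-concatMap f g (x ∷ xs) = trans (sumMap-++ f (g x) _) (cong (sumMap f (g x) +_) (sumMap-concatMap f g xs))

sumMap-cartesianProduct : ∀ (f : A × B → ℕ) xs ys →
  sumMap f (cartesianProduct xs ys) ≡ sumMap (λ x → sumMap (λ y → f (x , y)) ys) xs
sumMap-cartesianProduct f []       ys = refl
sumMap-cartesianProduct f (x ∷ xs) ys = trans (sumMap-++ f (map (x ,_) ys) _)
  (cong₂ _+_ (sumMap-map f (x ,_) ys) (sumMap-cartesianProduct f xs ys))

sumMap-tabulate : ∀ {k} (f : A → ℕ) (g : Fin k → A) → sumMap f (tabulate g) ≡ sumFin (λ i → f (g i))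
sumMap-tabulate {k = zero}  f g = refl
sumMap-tabulate {k = suc k} f g = cong (f (g zero) +_) (sumMap-tabulate f (λ i → g (suc i)))

countList-sumMap : ∀ (P : A → Bool) xs → countList P xs ≡ sumMap (λ x → if P x then 1 else 0) xs
countList-sumMap P []       = refl
countList-sumMap P (x ∷ xs) = cong ((if P x then 1 else 0) +_) (countList-sumMap P xs)

countList-+-countList-not : ∀ (P : A → Bool) xs →
  countList P xs + countList (λ x → not (P x)) xs ≡ sumMap (λ _ → 1) xs
countList-+-countList-not P []       = refl
countList-+-countList-not P (x ∷ xs) with P x
... | true  = cong suc (countList-+-countList-not P xs)
... | false = trans (+-suc _ _) (cong suc (countList-+-countList-not P xs))

countList-*-≤-sumMap : ∀ (P : A → Bool) (f : A → ℕ) t xs → (∀ x → T (P x) → t ≤ f x) →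
  countList P xs * t ≤ sumMap f xs
countList-*-≤-sumMap P f t []       P⇒t≤f = z≤n
countList-*-≤-sumMap P f t (x ∷ xs) P⇒t≤f with P x in Px
... | true  = +-mono-≤ (P⇒t≤f x (subst T (sym Px) _)) (countList-*-≤-sumMap P f t xs P⇒t≤f)
... | false = ≤-trans (countList-*-≤-sumMap P f t xs P⇒t≤f) (m≤n+m _ (f x))

sumFin-cong : ∀ {k} {f g : Fin k → ℕ} → (∀ i → f i ≡ g i) → sumFin f ≡ sumFin g
sumFin-cong {zero}  f≗g = refl
sumFin-cong {suc k} f≗g = cong₂ _+_ (f≗g zero) (sumFin-cong (λ i → f≗g (suc i)))

sumFin-mono : ∀ {k} {f g : Fin k → ℕ} → (∀ i → f i ≤ g i) → sumFin f ≤ sumFin g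
sumFin-mono {zero}  f≤g = z≤n
sumFin-mono {suc k} f≤g = +-mono-≤ (f≤g zero) (sumFin-mono (λ i → f≤g (suc i)))

sumFin-const : ∀ k c → sumFin {k} (λ _ → c) ≡ k * c
sumFin-const zero    c = refl
sumFin-const (suc k) c = cong (c +_) (sumFin-const k c)

count-sumFin : ∀ {k} (P : Fin k → Bool) → count P ≡ sumFin (λ i → if P i then 1 else 0)
count-sumFin {zero}  P = refl
count-sumFin {suc k} P = cong ((if P zero then 1 else 0) +_) (count-sumFin (λ i → P (suc i)))

count-cong : ∀ {k} {P Q : Fin k → Bool} → (∀ i → P i ≡ Q i) → count P ≡ count Q
count-cong {zero}  P≗Q = refl
count-cong {suc k} P≗Q = cong₂ _+_ (cong (λ b → if b then 1 else 0) (P≗Q zero)) (count-cong (λ i → P≗Q (suc i)))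

count-mono : ∀ {k} {P Q : Fin k → Bool} → (∀ i → T (P i) → T (Q i)) → count P ≤ count Q
count-mono {zero}          P⇒Q = z≤n
count-mono {suc k} {P} {Q} P⇒Q with P zero in P₀ | Q zero in Q₀
... | true  | true  = s≤s (count-mono (λ i → P⇒Q (suc i)))
... | false | true  = m≤n⇒m≤1+n (count-mono (λ i → P⇒Q (suc i)))
... | false | false = count-mono (λ i → P⇒Q (suc i))
... | true  | false = ⊥-elim (subst T Q₀ (P⇒Q zero (subst T (sym P₀) _)))

count-false : ∀ {k} {P : Fin k → Bool} → (∀ i → P i ≡ false) → count P ≡ 0
count-false {zero}      P≡false = refl
count-false {suc k} {P} P≡false rewrite P≡false zero = count-false (λ i → P≡false (suc i))

allPairs : (n : ℕ) → List (Fin n × Fin n)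
allPairs n = cartesianProduct (allFin n) (allFin n)

sumMap-allPairs : ∀ {n} (f : Fin n × Fin n → ℕ) →
  sumMap f (allPairs n) ≡ sumFin (λ i → sumFin (λ j → f (i , j)))
sumMap-allPairs {n} f = begin
  sumMap f (allPairs n)                                          ≡⟨ sumMap-cartesianProduct f (allFin n) (allFin n) ⟩
  sumMap (λ i → sumMap (λ j → f (i , j)) (allFin n)) (allFin n)  ≡⟨ sumMap-tabulate {k = n} _ (λ i → i) ⟩
  sumFin (λ i → sumMap (λ j → f (i , j)) (allFin n))
    ≡⟨ sumFin-cong {n} (λ i → sumMap-tabulate {k = n} _ (λ j → j)) ⟩
  sumFin (λ i → sumFin (λ j → f (i , j)))                        ∎
  where open ≡-Reasoning

sumMap-const-allPairs : ∀ n c → sumMap (λ _ → c) (allPairs n) ≡ n * n * c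
sumMap-const-allPairs n c = begin
  sumMap (λ _ → c) (allPairs n)                ≡⟨ sumMap-allPairs {n} (λ _ → c) ⟩
  sumFin {n} (λ _ → sumFin {n} (λ _ → c))      ≡⟨ sumFin-cong {n} (λ _ → sumFin-const n c) ⟩
  sumFin {n} (λ _ → n * c)                     ≡⟨ sumFin-const n (n * c) ⟩
  n * (n * c)                                  ≡⟨ *-assoc n n c ⟨
  n * n * c                                    ∎
  where open ≡-Reasoning

countList-allPairs : ∀ {n} (P : Fin n × Fin n → Bool) →
  countList P (allPairs n) ≡ sumFin (λ i → count (λ j → P (i , j)))
countList-allPairs {n} P = trans (countList-sumMap P (allPairs n)) (trans (sumMap-allPairs {n} _)
  (sumFin-cong {n} (λ i → sym (count-sumFin (λ j → P (i , j))))))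

sumMap-allSamples-suc : ∀ {n m} (f : Vec (Fin n × Fin n) (suc m) → ℕ) →
  sumMap f (allSamples n (suc m)) ≡ sumMap (λ e → sumMap (λ s → f (e ∷ s)) (allSamples n m)) (allPairs n)
sumMap-allSamples-suc {n} {m} f = trans (sumMap-concatMap f _ (allPairs n))
  (sumMap-cong (allPairs n) (λ e → sumMap-map f (e ∷_) (allSamples n m)))

sumMap-const-allSamples : ∀ n m c → sumMap (λ _ → c) (allSamples n m) ≡ (n * n) ^ m * c
sumMap-const-allSamples n zero    c = trans (+-identityʳ c) (sym (+-identityʳ c))
sumMap-const-allSamples n (suc m) c = begin
  sumMap (λ _ → c) (allSamples n (suc m))                        ≡⟨ sumMap-allSamples-suc {n} {m} (λ _ → c) ⟩
  sumMap (λ _ → sumMap (λ _ → c) (allSamples n m)) (allPairs n)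
    ≡⟨ sumMap-cong (allPairs n) (λ _ → sumMap-const-allSamples n m c) ⟩
  sumMap (λ _ → (n * n) ^ m * c) (allPairs n)                    ≡⟨ sumMap-const-allPairs n _ ⟩
  n * n * ((n * n) ^ m * c)                                      ≡⟨ *-assoc (n * n) _ c ⟨
  (n * n) ^ suc m * c                                            ∎
  where open ≡-Reasoning

-- Expected running time of a process driven by uniform samples

module Drift {n : ℕ} {St : Set} (step : St → Fin n × Fin n → St) (live : St → Bool) where

  liveSteps : ∀ {m} → St → Vec (Fin n × Fin n) m → ℕ
  liveSteps S []      = 0
  liveSteps S (e ∷ s) = if live S then suc (liveSteps (step S e) s) else 0

  liveSteps-live : ∀ {m} S e (s : Vec _ m) → T (live S) → liveSteps S (e ∷ s) ≡ suc (liveSteps (step S e) s)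
  liveSteps-live S e s S-live with live S
  ... | true = refl

  liveSteps-dead : ∀ {m} S e (s : Vec _ m) → ¬ T (live S) → liveSteps S (e ∷ s) ≡ 0
  liveSteps-dead S e s S-dead with live S
  ... | true  = ⊥-elim (S-dead _)
  ... | false = refl

  module _ (Φ : St → ℕ) (p q : ℕ)
    (Φ-step-≤ : ∀ S e → Φ (step S e) ≤ Φ S)
    (Φ-drops-often : ∀ S → T (live S) → p * (n * n) ≤ q * countList (λ e → Φ (step S e) <ᵇ Φ S) (allPairs n))
    where

    -- In probabilistic terms: E[liveSteps S] ≤ (q / p) · Φ S for m uniform samples.
    sum-liveSteps-≤ : ∀ m S → p * sumMap (liveSteps S) (allSamples n m) ≤ q * ((n * n) ^ m * Φ S)
    sum-liveSteps-≤ zero    S = ≤-trans (≤-reflexive (*-zeroʳ p)) z≤n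
    sum-liveSteps-≤ (suc m) S with T? (live S)
    ... | no S-dead = ≤-trans (≤-reflexive (trans (cong (p *_) sum-dead) (*-zeroʳ p))) z≤n
      where
      sum-dead : sumMap (liveSteps S) (allSamples n (suc m)) ≡ 0
      sum-dead = begin
        sumMap (liveSteps S) (allSamples n (suc m))
          ≡⟨ sumMap-cong (allSamples n (suc m)) (λ { (e ∷ s) → liveSteps-dead S e s S-dead }) ⟩
        sumMap (λ _ → 0) (allSamples n (suc m))      ≡⟨ sumMap-const-allSamples n (suc m) 0 ⟩
        (n * n) ^ suc m * 0                          ≡⟨ *-zeroʳ ((n * n) ^ suc m) ⟩
        0                                            ∎
        where open ≡-Reasoning
    ... | yes S-live = begin
        p * sumMap (liveSteps S) (allSamples n (suc m))  ≡⟨ cong (p *_) sum-live ⟩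
        p * (N * Nᵐ + sumMap G L)                        ≡⟨ expand p N Nᵐ _ ⟩
        Nᵐ * (p * N) + p * sumMap G L                    ≤⟨ +-mono-≤ (*-monoʳ-≤ Nᵐ (Φ-drops-often S S-live)) ih ⟩
        Nᵐ * (q * drops) + q * (Nᵐ * sumMap Φ′ L)        ≡⟨ collect q Nᵐ drops _ ⟩
        q * (Nᵐ * (drops + sumMap Φ′ L))                 ≤⟨ *-monoʳ-≤ q (*-monoʳ-≤ Nᵐ drift) ⟩
        q * (Nᵐ * (N * Φ S))                             ≡⟨ cong (q *_) (reorder Nᵐ N (Φ S)) ⟩
        q * (N * Nᵐ * Φ S)                               ∎
      where
      open ≤-Reasoning
      N  = n * n
      Nᵐ = N ^ m
      L  = allPairs n
      Sᵐ = allSamples n m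
      G : Fin n × Fin n → ℕ
      G e = sumMap (liveSteps (step S e)) Sᵐ
      Φ′ : Fin n × Fin n → ℕ
      Φ′ e = Φ (step S e)
      drops = countList (λ e → Φ′ e <ᵇ Φ S) L

      expand : ∀ p N Nᵐ G → p * (N * Nᵐ + G) ≡ Nᵐ * (p * N) + p * G
      expand = solve-∀
      collect : ∀ q Nᵐ c φ → Nᵐ * (q * c) + q * (Nᵐ * φ) ≡ q * (Nᵐ * (c + φ))
      collect = solve-∀
      reorder : ∀ Nᵐ N φ → Nᵐ * (N * φ) ≡ N * Nᵐ * φ
      reorder = solve-∀

      sum-live : sumMap (liveSteps S) (allSamples n (suc m)) ≡ N * Nᵐ + sumMap G L
      sum-live = trans (sumMap-allSamples-suc {n} {m} (liveSteps S)) (trans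
        (sumMap-cong L (λ e → trans (sumMap-cong Sᵐ (λ s → liveSteps-live S e s S-live))
          (trans (sumMap-+ (λ _ → 1) _ Sᵐ) (cong (_+ G e) (trans (sumMap-const-allSamples n m 1) (*-identityʳ Nᵐ))))))
        (trans (sumMap-+ (λ _ → Nᵐ) G L) (cong (_+ sumMap G L) (sumMap-const-allPairs n Nᵐ))))

      ih : p * sumMap G L ≤ q * (Nᵐ * sumMap Φ′ L)
      ih = begin
        p * sumMap G L                     ≡⟨ sumMap-*ˡ p G L ⟨
        sumMap (λ e → p * G e) L           ≤⟨ sumMap-mono L (λ e → sum-liveSteps-≤ m (step S e)) ⟩
        sumMap (λ e → q * (Nᵐ * Φ′ e)) L   ≡⟨ sumMap-*ˡ q _ L ⟩
        q * sumMap (λ e → Nᵐ * Φ′ e) L     ≡⟨ cong (q *_) (sumMap-*ˡ Nᵐ Φ′ L) ⟩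
        q * (Nᵐ * sumMap Φ′ L)             ∎

      drop+Φ′-≤ : ∀ e → (if Φ′ e <ᵇ Φ S then 1 else 0) + Φ′ e ≤ Φ S
      drop+Φ′-≤ e with Φ′ e <ᵇ Φ S in Φ-drops
      ... | true  = <ᵇ⇒< (Φ′ e) (Φ S) (subst T (sym Φ-drops) _)
      ... | false = Φ-step-≤ S e

      drift : drops + sumMap Φ′ L ≤ N * Φ S
      drift = begin
        drops + sumMap Φ′ L                                         ≡⟨ cong (_+ sumMap Φ′ L) (countList-sumMap _ L) ⟩
        sumMap (λ e → if Φ′ e <ᵇ Φ S then 1 else 0) L + sumMap Φ′ L ≡⟨ sumMap-+ _ Φ′ L ⟨
        sumMap (λ e → (if Φ′ e <ᵇ Φ S then 1 else 0) + Φ′ e) L      ≤⟨ sumMap-mono L drop+Φ′-≤ ⟩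
        sumMap (λ _ → Φ S) L                                        ≡⟨ sumMap-const-allPairs n (Φ S) ⟩
        N * Φ S                                                     ∎

-- Binary rank

bit-injective : ∀ {u v} → bit u ≡ bit v → u ≡ v
bit-injective {false} {false} _ = refl
bit-injective {true}  {true}  _ = refl

≡⇒differ≡false : ∀ {u v} → u ≡ v → differ u v ≡ false
≡⇒differ≡false {false} refl = refl
≡⇒differ≡false {true}  refl = refl

binRank-reindex : ∀ {A′ B′ : Set} {d} (W : Matrix A B) (f : A′ → A) (g : B′ → B) →
  BinRankLe d W → BinRankLe d (λ a b → W (f a) (g b))
binRank-reindex W f g (R , C , RC) = (λ k a → R k (f a)) , (λ k b → C k (g b)) , λ a b → RC (f a) (g b)

binRank-transpose : ∀ {d} (W : Matrix A B) → BinRankLe d W → BinRankLe d (λ b a → W a b)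
binRank-transpose W (R , C , RC) = C , R , λ b a → trans (count-cong (λ k → Bool.∧-comm (C k b) (R k a))) (RC a b)

liftMatrix : Matrix A B → Matrix (Maybe A) (Maybe B)
liftMatrix W (just a) (just b) = W a b
liftMatrix W _        _        = false

binRank-lift : ∀ {d} (W : Matrix A B) → BinRankLe d W → BinRankLe d (liftMatrix W)
binRank-lift {A} {B} {d} W (R , C , RC) = R⁺ , C⁺ , RC⁺
  where
  R⁺ : Fin d → Maybe A → Bool
  R⁺ k (just a) = R k a
  R⁺ k nothing  = false
  C⁺ : Fin d → Maybe B → Bool
  C⁺ k (just b) = C k b
  C⁺ k nothing  = false
  RC⁺ : ∀ a b → count (λ k → R⁺ k a ∧ C⁺ k b) ≡ bit (liftMatrix W a b)
  RC⁺ (just a) (just b) = RC a b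
  RC⁺ (just a) nothing  = count-false (λ k → Bool.∧-zeroʳ (R k a))
  RC⁺ nothing  _        = count-false {d} (λ k → refl)

injective⇒≤2^ : ∀ {a d} (f : Fin a → Fin d → Bool) →
  (∀ i i′ → (∀ k → f i k ≡ f i′ k) → i ≡ i′) → a ≤ 2 ^ d
injective⇒≤2^ {a} {d} f f-inj = injective⇒≤ {f = encode} (λ {i} {i′} eq → f-inj i i′ (λ k →
    trans (sym (decode-encode i k)) (trans (cong (λ c → to (finToFun c k)) eq) (decode-encode i′ k))))
  where
  open Inverse 2↔Bool
  encode : Fin a → Fin (2 ^ d)
  encode i = funToFin (λ k → from (f i k))
  decode-encode : ∀ i k → to (finToFun (encode i) k) ≡ f i k
  decode-encode i k = trans (cong to (finToFun-funToFin (λ k → from (f i k)) k)) (strictlyInverseˡ (f i k))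

distinctRows-≤-2^ : ∀ {a d} (W : Matrix (Fin a) B) → BinRankLe d W →
  (∀ i i′ → (∀ j → W i j ≡ W i′ j) → i ≡ i′) → a ≤ 2 ^ d
distinctRows-≤-2^ W (R , C , RC) distinct = injective⇒≤2^ (λ i k → R k i) (λ i i′ sameRects → distinct i i′ (λ j →
  bit-injective (trans (sym (RC i j))
    (trans (count-cong (λ k → cong (_∧ C k j) (sameRects k))) (RC i′ j)))))

Searchable : Set → Set₁
Searchable A = (P : A → Set) → (∀ a → Dec (P a)) → Dec (∃ P)

search-Bool : Searchable Bool
search-Bool P P? = map′ (λ { (inj₁ p) → true , p ; (inj₂ p) → false , p })
  (λ { (true , p) → inj₁ p ; (false , p) → inj₂ p }) (P? true ⊎-dec P? false)

search-Vec : Searchable A → ∀ k → Searchable (Vec A k)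
search-Vec search zero    P P? = map′ ([] ,_) (λ { ([] , p) → p }) (P? [])
search-Vec search (suc k) P P? = map′ (λ (x , xs , p) → x ∷ xs , p) (λ { (x ∷ xs , p) → x , xs , p })
  (search (λ x → ∃ λ xs → P (x ∷ xs)) (λ x → search-Vec search k (λ xs → P (x ∷ xs)) (λ xs → P? (x ∷ xs))))

binRank? : ∀ d {a b} (W : Matrix (Fin a) (Fin b)) → Dec (BinRankLe d W)
binRank? d {a} {b} W = map′ fromTables toTables
  (search-Vec (search-Vec search-Bool a) d _ λ Rs →
   search-Vec (search-Vec search-Bool b) d _ λ Cs →
   all? λ i → all? λ j → count (λ k → entry Rs k i ∧ entry Cs k j) ≟ bit (W i j))
  where
  entry : ∀ {c} → Vec (Vec Bool c) d → Fin d → Fin c → Bool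
  entry Ts k i = Vec.lookup (Vec.lookup Ts k) i
  table : ∀ {c} → (Fin d → Fin c → Bool) → Vec (Vec Bool c) d
  table R = Vec.tabulate (λ k → Vec.tabulate (R k))
  entry-table : ∀ {c} (R : Fin d → Fin c → Bool) k i → entry (table R) k i ≡ R k i
  entry-table R k i = trans (cong (λ v → Vec.lookup v i) (lookup∘tabulate _ k)) (lookup∘tabulate (R k) i)
  fromTables : _ → BinRankLe d W
  fromTables (Rs , Cs , RC) = entry Rs , entry Cs , RC
  toTables : BinRankLe d W → _
  toTables (R , C , RC) = table R , table C , λ i j →
    trans (count-cong (λ k → cong₂ _∧_ (entry-table R k i) (entry-table C k j))) (RC i j)

-- The sampling process

module Process {n : ℕ} (M : Mat n) (d : ℕ) where

  record State : Set where
    constructor state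
    field
      {height width} : ℕ
      rows : Vec (Fin n) height
      cols : Vec (Fin n) width
  open State

  size : State → ℕ
  size S = height S + width S

  sub : (S : State) → Matrix (Fin (height S)) (Fin (width S))
  sub S i j = M (Vec.lookup (rows S) i) (Vec.lookup (cols S) j)

  rowSetoid : ∀ {b} → Vec (Fin n) b → Setoid 0ℓ 0ℓ
  rowSetoid {b} ys = On.setoid (Fin b →-setoid Bool) (λ x j → M x (Vec.lookup ys j))

  colSetoid : ∀ {a} → Vec (Fin n) a → Setoid 0ℓ 0ℓ
  colSetoid {a} xs = On.setoid (Fin a →-setoid Bool) (λ y i → M (Vec.lookup xs i) y)

  RowAgree : ∀ {b} → Vec (Fin n) b → Fin n → Fin n → Set
  RowAgree ys = Setoid._≈_ (rowSetoid ys)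

  ColAgree : ∀ {a} → Vec (Fin n) a → Fin n → Fin n → Set
  ColAgree xs = Setoid._≈_ (colSetoid xs)

  rowAgree-tail : ∀ {b y} {ys : Vec (Fin n) b} {x x′} → RowAgree (y ∷ ys) x x′ → RowAgree ys x x′
  rowAgree-tail x≈x′ j = x≈x′ (suc j)

  colAgree-tail : ∀ {a x} {xs : Vec (Fin n) a} {y y′} → ColAgree (x ∷ xs) y y′ → ColAgree xs y y′
  colAgree-tail y≈y′ i = y≈y′ (suc i)

  Reduced : State → Set
  Reduced S = Unique (rowSetoid (cols S)) (rows S) × Unique (colSetoid (rows S)) (cols S)

  RowStatus : State → Fin n → Set
  RowStatus S x = All (λ v → ¬ RowAgree (cols S) x v) (rows S) ⊎ Any (RowAgree (cols S) x) (rows S)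

  ColStatus : State → Fin n → Set
  ColStatus S y = All (λ w → ¬ ColAgree (rows S) y w) (cols S) ⊎ Any (ColAgree (rows S) y) (cols S)

  pointwise? : ∀ {c} (f g : Fin c → Bool) → Dec (∀ j → f j ≡ g j)
  pointwise? f g = all? (λ j → f j Bool.≟ g j)

  rowStatus : ∀ S x → RowStatus S x
  rowStatus S x = All.decide (λ v → Sum.swap (toSum (pointwise? _ _))) (rows S)

  colStatus : ∀ S y → ColStatus S y
  colStatus S y = All.decide (λ w → Sum.swap (toSum (pointwise? _ _))) (cols S)

  representative : ∀ {k} {P Q : Fin n → Set} {vs : Vec (Fin n) k} → All P vs ⊎ Any Q vs → Maybe (Fin k)
  representative (inj₁ _) = nothing
  representative (inj₂ i) = just (Any.index i)

  data Move : Set where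
    stay addRow addCol addBoth : Move

  apply : Move → State → Fin n → Fin n → State
  apply stay    S             x y = S
  apply addRow  (state xs ys) x y = state (x ∷ xs) ys
  apply addCol  (state xs ys) x y = state xs (y ∷ ys)
  apply addBoth (state xs ys) x y = state (x ∷ xs) (y ∷ ys)

  move : ∀ S x y → RowStatus S x → ColStatus S y → Move
  move S x y (inj₁ _) (inj₁ _) = addBoth
  move S x y (inj₁ _) (inj₂ _) = addRow
  move S x y (inj₂ _) (inj₁ _) = addCol
  move S x y (inj₂ i) (inj₂ j) = if differ (M x y) (sub S (Any.index i) (Any.index j)) then addBoth else stay

  moveAt : State → Fin n → Fin n → Move
  moveAt S x y = move S x y (rowStatus S x) (colStatus S y)

  step : State → Fin n × Fin n → State
  step S (x , y) = apply (moveAt S x y) S x y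

  extension : State → Mat n
  extension S x y = liftMatrix (sub S) (representative (rowStatus S x)) (representative (colStatus S y))

  size≤apply : ∀ mv S x y → size S ≤ size (apply mv S x y)
  size≤apply stay    S             x y = ≤-refl
  size≤apply addRow  (state xs ys) x y = n≤1+n _
  size≤apply addCol  (state xs ys) x y = +-monoʳ-≤ _ (n≤1+n _)
  size≤apply addBoth (state xs ys) x y = +-mono-≤ (n≤1+n _) (n≤1+n _)

  size<apply : ∀ mv S x y → mv ≢ stay → size S < size (apply mv S x y)
  size<apply stay    S             x y mv≢stay = ⊥-elim (mv≢stay refl)
  size<apply addRow  (state xs ys) x y _ = ≤-refl
  size<apply addCol  (state xs ys) x y _ = +-monoʳ-< _ (n<1+n _)
  size<apply addBoth (state xs ys) x y _ = s≤s (+-monoʳ-≤ _ (n≤1+n _))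

  extension-differs⇒moves : ∀ S x y (rs : RowStatus S x) (cs : ColStatus S y) →
    T (differ (M x y) (liftMatrix (sub S) (representative rs) (representative cs))) → move S x y rs cs ≢ stay
  extension-differs⇒moves S x y (inj₁ _) (inj₁ _) _ ()
  extension-differs⇒moves S x y (inj₁ _) (inj₂ _) _ ()
  extension-differs⇒moves S x y (inj₂ _) (inj₁ _) _ ()
  extension-differs⇒moves S x y (inj₂ i) (inj₂ j) differs with differ (M x y) (sub S (Any.index i) (Any.index j))
  ... | true  = λ ()
  ... | false = ⊥-elim differs

  reduced-apply-move : ∀ S x y (rs : RowStatus S x) (cs : ColStatus S y) →
    Reduced S → Reduced (apply (move S x y rs cs) S x y)
  reduced-apply-move S x y (inj₁ newRow) (inj₁ newCol) (xs! , ys!) =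
    All.map (_∘ rowAgree-tail) newRow ∷ AllPairs.map (_∘ rowAgree-tail) xs! ,
    All.map (_∘ colAgree-tail) newCol ∷ AllPairs.map (_∘ colAgree-tail) ys!
  reduced-apply-move S x y (inj₁ newRow) (inj₂ _) (xs! , ys!) = newRow ∷ xs! , AllPairs.map (_∘ colAgree-tail) ys!
  reduced-apply-move S x y (inj₂ _) (inj₁ newCol) (xs! , ys!) = AllPairs.map (_∘ rowAgree-tail) xs! , newCol ∷ ys!
  reduced-apply-move S@(state xs ys) x y (inj₂ i) (inj₂ j) (xs! , ys!)
    with differ (M x y) (sub S (Any.index i) (Any.index j)) in mismatch
  ... | false = xs! , ys!
  ... | true  = All.lookup⁻ newRow ∷ AllPairs.map (_∘ rowAgree-tail) xs! ,
                All.lookup⁻ newCol ∷ AllPairs.map (_∘ colAgree-tail) ys!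
    where
    i₀ = Any.index i
    j₀ = Any.index j
    x≈i₀ : RowAgree ys x (Vec.lookup xs i₀)
    x≈i₀ = lookup-index i
    y≈j₀ : ColAgree xs y (Vec.lookup ys j₀)
    y≈j₀ = lookup-index j
    x-y-mismatch : M x y ≢ M (Vec.lookup xs i₀) (Vec.lookup ys j₀)
    x-y-mismatch eq = subst T (trans (sym mismatch) (≡⇒differ≡false eq)) _
    -- Row i₀ is the only row agreeing with x on the old columns, and the new column y
    -- separates it from x because M x y differs from the entry at (i₀, j₀).
    newRow : ∀ i′ → ¬ RowAgree (y ∷ ys) x (Vec.lookup xs i′)
    newRow i′ x≈i′
      with lookup-injective (rowSetoid ys) xs! i₀ i′ (λ j′ → trans (sym (x≈i₀ j′)) (x≈i′ (suc j′)))
    ... | refl = x-y-mismatch (trans (x≈i′ zero) (y≈j₀ i₀))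
    newCol : ∀ j′ → ¬ ColAgree (x ∷ xs) y (Vec.lookup ys j′)
    newCol j′ y≈j′
      with lookup-injective (colSetoid xs) ys! j₀ j′ (λ i′ → trans (sym (y≈j₀ i′)) (y≈j′ (suc i′)))
    ... | refl = x-y-mismatch (trans (y≈j′ zero) (x≈i₀ j₀))

  size-≤ : ∀ S → Reduced S → BinRankLe d (sub S) → size S ≤ 2 ^ d + 2 ^ d
  size-≤ S (xs! , ys!) S≤d = +-mono-≤
    (distinctRows-≤-2^ (sub S) S≤d (lookup-injective (rowSetoid (cols S)) xs!))
    (distinctRows-≤-2^ (λ j i → sub S i j) (binRank-transpose (sub S) S≤d) (lookup-injective (colSetoid (rows S)) ys!))

  binRank-extension : ∀ S → BinRankLe d (sub S) → BinRankLe d (extension S)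
  binRank-extension S S≤d = binRank-reindex (liftMatrix (sub S))
    (λ x → representative (rowStatus S x)) (λ y → representative (colStatus S y)) (binRank-lift (sub S) S≤d)

  Contained : State → List (Fin n × Fin n) → Set
  Contained S F = All (_∈ map proj₁ F) (rows S) × All (_∈ map proj₂ F) (cols S)

  contained-apply : ∀ mv S {x y F} → (x , y) ∈ F → Contained S F → Contained (apply mv S x y) F
  contained-apply stay    S xy∈F (xs⊆ , ys⊆) = xs⊆ , ys⊆
  contained-apply addRow  S xy∈F (xs⊆ , ys⊆) = ∈-map⁺ proj₁ xy∈F ∷ xs⊆ , ys⊆
  contained-apply addCol  S xy∈F (xs⊆ , ys⊆) = xs⊆ , ∈-map⁺ proj₂ xy∈F ∷ ys⊆
  contained-apply addBoth S xy∈F (xs⊆ , ys⊆) = ∈-map⁺ proj₁ xy∈F ∷ xs⊆ , ∈-map⁺ proj₂ xy∈F ∷ ys⊆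

  binRank-sub : ∀ S F → Contained S F → BinRankLe d (induced M F) → BinRankLe d (sub S)
  binRank-sub S F (xs⊆ , ys⊆) =
    binRank-reindex (induced M F) (λ i → _ , All.lookup⁺ xs⊆ i) (λ j → _ , All.lookup⁺ ys⊆ j)

  ReducedState : Set
  ReducedState = Σ State Reduced

  empty : ReducedState
  empty = state [] [] , [] , []

  stepᴿ : ReducedState → Fin n × Fin n → ReducedState
  stepᴿ (S , S!) (x , y) = step S (x , y) , reduced-apply-move S x y (rowStatus S x) (colStatus S y) S!

  live : ReducedState → Bool
  live (S , _) = isYes (binRank? d (sub S))

  open Drift stepᴿ live public

  accepted⇒liveSteps≡ : ∀ {k} S (s : Vec (Fin n × Fin n) k) F → Contained (proj₁ S) F →
    (∀ e → e ∈ toList s → e ∈ F) → BinRankLe d (induced M F) → liveSteps S s ≡ k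
  accepted⇒liveSteps≡ S        []            F S⊆F s⊆F F≤d = refl
  accepted⇒liveSteps≡ (S , S!) ((x , y) ∷ s) F S⊆F s⊆F F≤d = begin
    liveSteps (S , S!) ((x , y) ∷ s)           ≡⟨ liveSteps-live _ _ s S-live ⟩
    suc (liveSteps (stepᴿ (S , S!) (x , y)) s) ≡⟨ cong suc (accepted⇒liveSteps≡ _ s F S′⊆F (λ e → s⊆F e ∘ there) F≤d) ⟩
    suc _                                      ∎
    where
    open ≡-Reasoning
    S-live : T (live (S , S!))
    S-live = fromWitness {a? = binRank? d (sub S)} (binRank-sub S F S⊆F F≤d)
    S′⊆F : Contained (step S (x , y)) F
    S′⊆F = contained-apply (moveAt S x y) S (s⊆F _ (here refl)) S⊆F

  capacity : ℕ
  capacity = 2 * (2 ^ d + 1)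

  potential : ReducedState → ℕ
  potential (S , _) = capacity ∸ size S

  potential-step-≤ : ∀ S e → potential (stepᴿ S e) ≤ potential S
  potential-step-≤ (S , _) (x , y) = ∸-monoʳ-≤ capacity (size≤apply (moveAt S x y) S x y)

  size<capacity : ∀ S → T (live S) → size (proj₁ S) < capacity
  size<capacity (S , S!) S-live = begin-strict
    size S                   ≤⟨ size-≤ S S! (toWitness {a? = binRank? d (sub S)} S-live) ⟩
    2 ^ d + 2 ^ d            <⟨ n<1+n _ ⟩
    suc (2 ^ d + 2 ^ d)      ≤⟨ n≤1+n _ ⟩
    suc (suc (2 ^ d + 2 ^ d)) ≡⟨ double+1 (2 ^ d) ⟩
    capacity                 ∎
    where
    open ≤-Reasoning
    double+1 : ∀ t → suc (suc (t + t)) ≡ 2 * (t + 1)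
    double+1 = solve-∀

  potential-drops-often : ∀ {p q} → FarFromBinRank p q d M → ∀ S → T (live S) →
    p * (n * n) ≤ q * countList (λ e → potential (stepᴿ S e) <ᵇ potential S) (allPairs n)
  potential-drops-often {p} {q} far S@(S₀ , _) S-live =
    <⇒≤ (<-≤-trans (far (extension S₀) (binRank-extension S₀ S₀≤d)) (*-monoʳ-≤ q dist≤drops))
    where
    S₀≤d : BinRankLe d (sub S₀)
    S₀≤d = toWitness {a? = binRank? d (sub S₀)} S-live
    drops : ∀ x y → T (differ (M x y) (extension S₀ x y)) → T (potential (stepᴿ S (x , y)) <ᵇ potential S)
    drops x y differs = <⇒<ᵇ (≤-<-trans
      (∸-monoʳ-≤ capacity (size<apply (moveAt S₀ x y) S₀ x y moves))
      (∸-monoʳ-< (n<1+n _) (size<capacity S S-live)))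
      where
      moves : moveAt S₀ x y ≢ stay
      moves = extension-differs⇒moves S₀ x y (rowStatus S₀ x) (colStatus S₀ y) differs
    dist≤drops : dist M (extension S₀) ≤ countList (λ e → potential (stepᴿ S e) <ᵇ potential S) (allPairs n)
    dist≤drops = ≤-trans (sumFin-mono (λ x → count-mono (drops x))) (≤-reflexive (sym (countList-allPairs {n} _)))

m≤n*ceilDiv : ∀ m n .{{_ : NonZero n}} → m ≤ n * ceilDiv m n
m≤n*ceilDiv m n@(suc k) = +-cancelˡ-≤ k m _ (begin
  k + m                              ≡⟨ +-comm k m ⟩
  m + k                              ≡⟨ m≡m%n+[m/n]*n (m + k) n ⟩
  (m + k) % n + (m + k) / n * n      ≤⟨ +-mono-≤ (s≤s⁻¹ (m%n<n (m + k) n)) (≤-reflexive (*-comm _ n)) ⟩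
  k + n * ((m + k) / n)              ≡⟨ cong (λ t → k + n * (t / n)) (cong (_∸ 1) (+-suc m k)) ⟨
  k + n * ceilDiv m n                ∎)
  where open ≤-Reasoning

12*c≤N : ∀ p q m D c N .{{_ : NonZero (D * q)}} → 24 * D * q ≤ p * m → p * (c * m) ≤ q * (N * (2 * D)) → 12 * c ≤ N
12*c≤N p q m D c N m-large c-bound = *-cancelʳ-≤ (12 * c) N (2 * (D * q)) {{m*n≢0 2 (D * q)}} (begin
  12 * c * (2 * (D * q))  ≡⟨ regroup₁ c D q ⟩
  c * (24 * D * q)        ≤⟨ *-monoʳ-≤ c m-large ⟩
  c * (p * m)             ≡⟨ regroup₂ c p m ⟩
  p * (c * m)             ≤⟨ c-bound ⟩
  q * (N * (2 * D))       ≡⟨ regroup₃ q N D ⟩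
  N * (2 * (D * q))       ∎)
  where
  open ≤-Reasoning
  regroup₁ : ∀ c D q → 12 * c * (2 * (D * q)) ≡ c * (24 * D * q)
  regroup₁ = solve-∀
  regroup₂ : ∀ c p m → c * (p * m) ≡ p * (c * m)
  regroup₂ = solve-∀
  regroup₃ : ∀ q N D → q * (N * (2 * D)) ≡ N * (2 * (D * q))
  regroup₃ = solve-∀

2*[c₁+c₀]≤3*c₁ : ∀ c₁ c₀ → 12 * c₀ ≤ c₁ + c₀ → 2 * (c₁ + c₀) ≤ 3 * c₁
2*[c₁+c₀]≤3*c₁ c₁ c₀ 12c₀≤c₁+c₀ = begin
  2 * (c₁ + c₀)      ≡⟨ *-distribˡ-+ 2 c₁ c₀ ⟩
  2 * c₁ + 2 * c₀    ≤⟨ +-monoʳ-≤ (2 * c₁) (≤-trans (*-monoˡ-≤ c₀ {2} {11} (s≤s (s≤s z≤n))) 11c₀≤c₁) ⟩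
  2 * c₁ + c₁        ≡⟨ +-comm (2 * c₁) c₁ ⟩
  3 * c₁             ∎
  where
  open ≤-Reasoning
  11c₀≤c₁ : 11 * c₀ ≤ c₁
  11c₀≤c₁ = +-cancelʳ-≤ c₀ (11 * c₀) c₁ (≤-trans (≤-reflexive (+-comm (11 * c₀) c₀)) 12c₀≤c₁+c₀)

lemma4 : (n d p q : ℕ) → .{{_ : NonZero p}} → .{{_ : NonZero q}} →
    (M : Mat n) → FarFromBinRank p q d M →
    Σ (Vec (Fin n × Fin n) (sampleSize d p q) → Bool) λ E →
      ((s : Vec (Fin n × Fin n) (sampleSize d p q)) →
        E s ≡ true → ¬ Accepts d M s) ×
      (2 * (n * n) ^ sampleSize d p q
        ≤ 3 * countList E (allSamples n (sampleSize d p q)))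
lemma4 n d p q M far = incomplete , incomplete⇒rejects , subst (λ N → 2 * N ≤ 3 * c₁) split
    (2*[c₁+c₀]≤3*c₁ c₁ c₀ (subst (12 * c₀ ≤_) (sym split)
      (12*c≤N p q m D c₀ ((n * n) ^ m) {{D*q≢0}} (m≤n*ceilDiv (24 * D * q) p) c₀-bound)))
  where
  open Process M d
  m = sampleSize d p q
  Sᵐ = allSamples n m
  D = 2 ^ d + 1

  incomplete : Vec (Fin n × Fin n) m → Bool
  incomplete s = liveSteps empty s <ᵇ m

  incomplete⇒rejects : ∀ s → incomplete s ≡ true → ¬ Accepts d M s
  incomplete⇒rejects s inc accepts = <-irrefl
    (accepted⇒liveSteps≡ empty s (toList s) ([] , []) (λ _ e∈s → e∈s) accepts)
    (<ᵇ⇒< _ m (subst T (sym inc) _))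

  complete⇒m≤liveSteps : ∀ s → T (not (incomplete s)) → m ≤ liveSteps empty s
  complete⇒m≤liveSteps s complete = ≮⇒≥ (λ lt → subst T (Equivalence.to Bool.T-not-≡ complete) (<⇒<ᵇ lt))

  c₁ = countList incomplete Sᵐ
  c₀ = countList (λ s → not (incomplete s)) Sᵐ

  split : c₁ + c₀ ≡ (n * n) ^ m
  split = trans (countList-+-countList-not incomplete Sᵐ) (trans (sumMap-const-allSamples n m 1) (*-identityʳ _))

  c₀-bound : p * (c₀ * m) ≤ q * ((n * n) ^ m * (2 * D))
  c₀-bound = ≤-trans (*-monoʳ-≤ p (countList-*-≤-sumMap _ (liveSteps empty) m Sᵐ complete⇒m≤liveSteps))
    (sum-liveSteps-≤ potential p q potential-step-≤ (potential-drops-often {p} {q} far) m empty)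

  D*q≢0 : NonZero (D * q)
  D*q≢0 = m*n≢0 D q {{>-nonZero (m≤n+m 1 (2 ^ d))}}
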